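{- Let $K$ be a field with $\mathrm{char}(K)\ne2,3$, $\Delta\in K^*$, $L=K[\delta]=K[T]/(T^2+3\Delta)$. Every element of $(L^*/L^{*3})_{N=1}$ equals $z(g)$ for some binary cubic form $g$ over $K$ of discriminant $\Delta$.
   Context: For $g=aX^3+bX^2Y+cXY^2+dY^3$: discriminant $b^2c^2-4ac^3-4b^3d-27a^2d^2+18abcd$; cubic covariant $G(X,Y)=(2b^3+27a^2d-9abc)X^3+3(b^2c+9abd-6ac^2)X^2Y-3(bc^2+9acd-6b^2d)XY^2-(2c^3+27ad^2-9bcd)Y^3$. $\delta$ is the image of $T$ in $L$; $\mathrm{N}_{L/K}(u+v\delta)=u^2+3\Delta v^2$; $(L^*/L^{*3})_{N=1}$ is the kernel of the induced norm map $L^*/L^{*3}\to K^*/K^{*3}$. Cardano covariant $C=\tfrac12(G+3\delta g)$; Cardano invariant $z(g)$ = class in $L^*/L^{*3}$ of $C(x,y)$ for any $x,y\in K$ with $C(x,y)\in L^*$ (independent of the choice). -}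

module Defs where

open import Level using (_⊔_)
open import Algebra.Bundles using (CommutativeRing)
open import Data.Product using (Σ; Σ-syntax; _×_; _,_; proj₁)
open import Relation.Nullary using (¬_)
open import Data.Nat using (ℕ; zero; suc)

module _ {c ℓ} (R : CommutativeRing c ℓ) where
  open CommutativeRing R

  record IsField : Set (c ⊔ ℓ) where
    field
      one≉zero : ¬ (1# ≈ 0#)
      inverse  : ∀ x → ¬ (x ≈ 0#) → Σ[ y ∈ Carrier ] (x * y ≈ 1#)

  two three : Carrier
  two = 1# + 1#
  three = 1# + 1# + 1#

  half : IsField → ¬ (two ≈ 0#) → Carrier
  half F h2 = proj₁ (IsField.inverse F two h2)

  cube : Carrier → Carrier
  cube t = t * t * t

  -- L = K[T]/(T² + 3Δ), element u + vδ represented by (u , v); δ² = -3Δ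
  L : Set c
  L = Carrier × Carrier

  _≈L_ : L → L → Set ℓ
  (u₁ , v₁) ≈L (u₂ , v₂) = (u₁ ≈ u₂) × (v₁ ≈ v₂)

  oneL : L
  oneL = 1# , 0#

  mulL : (Δ : Carrier) → L → L → L
  mulL Δ (u₁ , v₁) (u₂ , v₂) =
    (u₁ * u₂ - three * Δ * (v₁ * v₂)) , (u₁ * v₂ + v₁ * u₂)

  cubeL : (Δ : Carrier) → L → L
  cubeL Δ t = mulL Δ (mulL Δ t t) t

  normL : (Δ : Carrier) → L → Carrier
  normL Δ (u , v) = u * u + three * Δ * (v * v)

  IsUnitL : (Δ : Carrier) → L → Set (c ⊔ ℓ)
  IsUnitL Δ w = Σ[ w' ∈ L ] (mulL Δ w w' ≈L oneL)

  -- w ∈ L* represents an element of (L*/L*³)_{N=1}: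
  -- its norm lies in K*³
  NormIsCube : (Δ : Carrier) → L → Set (c ⊔ ℓ)
  NormIsCube Δ w = Σ[ t ∈ Carrier ] (normL Δ w ≈ cube t)

  SameClassL : (Δ : Carrier) → L → L → Set (c ⊔ ℓ)
  SameClassL Δ z w = Σ[ t ∈ L ] (IsUnitL Δ t × (z ≈L mulL Δ w (cubeL Δ t)))

  record BinCubic : Set c where
    constructor form
    field
      a b c' d : Carrier

  evalForm : BinCubic → Carrier → Carrier → Carrier
  evalForm (form a b c' d) x y =
    a * (x * x * x) + b * (x * x * y) + c' * (x * y * y) + d * (y * y * y)

  nat : ℕ → Carrier
  nat zero = 0#
  nat (suc n) = 1# + nat n

  disc : BinCubic → Carrier
  disc (form a b c' d) =
    b * b * (c' * c')
    - nat 4 * a * (c' * c' * c')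
    - nat 4 * (b * b * b) * d
    - nat 27 * (a * a) * (d * d)
    + nat 18 * a * b * c' * d

  covG : BinCubic → Carrier → Carrier → Carrier
  covG (form a b c' d) x y =
    (nat 2 * (b * b * b) + nat 27 * (a * a) * d - nat 9 * a * b * c') * (x * x * x)
    + nat 3 * (b * b * c' + nat 9 * a * b * d - nat 6 * a * (c' * c')) * (x * x * y)
    - nat 3 * (b * (c' * c') + nat 9 * a * c' * d - nat 6 * (b * b) * d) * (x * y * y)
    - (nat 2 * (c' * c' * c') + nat 27 * a * (d * d) - nat 9 * b * c' * d) * (y * y * y)

  -- Cardano covariant C = ½(G + 3δg) evaluated at (x,y), with h = ½
  cardano : (h : Carrier) → BinCubic → Carrier → Carrier → L
  cardano h g x y = (h * covG g x y) , (h * (nat 3 * evalForm g x y))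

  -- z(g) = w in L*/L*³ : for some x, y ∈ K with C(x,y) ∈ L*, C(x,y) has the class of w
  -- (the class is independent of the choice of x, y)
  CardanoInvIs : (h Δ : Carrier) → BinCubic → L → Set (c ⊔ ℓ)
  CardanoInvIs h Δ g w =
    Σ[ x ∈ Carrier ] Σ[ y ∈ Carrier ]
      (IsUnitL Δ (cardano h g x y) × SameClassL Δ (cardano h g x y) w)

-- Write w = u + vδ with N(w) = t³, t ≠ 0, and put s = 1/(2t). The form
--   g(X,Y) = 2/3 · (δ-coordinate of w·(X + sδY)³)
--          = (2/3)v X³ + 2su X²Y − 6s²Δv XY² − 2s³Δu Y³
-- has C(1,0) = (½G(1,0), (3/2)g(1,0)) = (2s)³N(w)·u + vδ = w, and its
-- discriminant is Δ·((2s)³N(w))² = Δ. Both are polynomial identities modulo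
-- 3k = 1 (k standing for 1/3); as char K is arbitrary, they are checked by the
-- ring solver with ℤ-coefficients, interpreted through the map ℤ → K.
module Submission where

open import Defs
open import Level using (Level)
open import Algebra.Bundles using (CommutativeRing)
open import Algebra.Solver.Ring.AlmostCommutativeRing
  using (fromCommutativeRing; _-Raw-AlmostCommutative⟶_)
open import Data.Product using (Σ-syntax; _×_; _,_; proj₁; proj₂)
open import Data.Maybe using (Maybe; just; nothing)
open import Data.Nat as ℕ using (zero; suc)
import Data.Nat.Properties as ℕP
open import Data.Integer as ℤ using (ℤ; +_; -[1+_]; _⊖_; _◃_; sign; ∣_∣)
import Data.Integer.Properties as ℤP
open import Data.Sign as Sign using (Sign)
open import Relation.Nullary using (¬_; yes; no)
import Relation.Binary.PropositionalEquality as ≡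

module IntegerCoefficients {c ℓ} (K : CommutativeRing c ℓ) where
  open CommutativeRing K
  open import Algebra.Properties.Semiring.Mult.TCOptimised semiring
    using (1+×; ×-homo-+; ×-cong; ×1-homo-*) renaming (_×_ to _·_)
  open import Algebra.Properties.Ring ring using (-‿distribˡ-*; -‿distribʳ-*)
  open import Algebra.Properties.AbelianGroup +-abelianGroup using (⁻¹-∙-comm; xyx⁻¹≈y)
  open import Algebra.Properties.Group +-group using (ε⁻¹≈ε; ⁻¹-involutive)
  open import Algebra.Properties.CommutativeSemigroup *-commutativeSemigroup using (interchange)
  open import Relation.Binary.Reasoning.Setoid setoid

  fromℤ : ℤ → Carrier
  fromℤ (+ n)    = n · 1#
  fromℤ -[1+ n ] = - (suc n · 1#)

  fromℤ-⊖ : ∀ m n → fromℤ (m ⊖ n) ≈ m · 1# - n · 1#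
  fromℤ-⊖ zero    zero    = sym (-‿inverseʳ 0#)
  fromℤ-⊖ zero    (suc n) = sym (+-identityˡ _)
  fromℤ-⊖ (suc m) zero    = sym (trans (+-congˡ ε⁻¹≈ε) (+-identityʳ _))
  fromℤ-⊖ (suc m) (suc n) rewrite ℤP.[1+m]⊖[1+n]≡m⊖n m n = begin
    fromℤ (m ⊖ n)                          ≈⟨ fromℤ-⊖ m n ⟩
    m · 1# - n · 1#                        ≈⟨ +-congʳ (xyx⁻¹≈y 1# _) ⟨
    (1# + m · 1#) - 1# - n · 1#            ≈⟨ +-assoc _ _ _ ⟩
    (1# + m · 1#) + (- 1# - n · 1#)        ≈⟨ +-cong (1+× m 1#) (sym (⁻¹-∙-comm 1# _)) ⟨
    suc m · 1# - (1# + n · 1#)             ≈⟨ +-congˡ (-‿cong (1+× n 1#)) ⟨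
    suc m · 1# - suc n · 1#                ∎

  fromℤ-+ : ∀ i j → fromℤ (i ℤ.+ j) ≈ fromℤ i + fromℤ j
  fromℤ-+ (+ m)    (+ n)    = ×-homo-+ 1# m n
  fromℤ-+ (+ m)    -[1+ n ] = fromℤ-⊖ m (suc n)
  fromℤ-+ -[1+ m ] (+ n)    = trans (fromℤ-⊖ n (suc m)) (+-comm _ _)
  fromℤ-+ -[1+ m ] -[1+ n ] = begin
    - (suc (suc (m ℕ.+ n)) · 1#)           ≈⟨ -‿cong (×-cong (ℕP.+-suc (suc m) n) refl) ⟨
    - ((suc m ℕ.+ suc n) · 1#)             ≈⟨ -‿cong (×-homo-+ 1# (suc m) (suc n)) ⟩
    - (suc m · 1# + suc n · 1#)            ≈⟨ ⁻¹-∙-comm _ _ ⟨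
    - (suc m · 1#) + - (suc n · 1#)        ∎

  fromSign : Sign → Carrier
  fromSign Sign.+ = 1#
  fromSign Sign.- = - 1#

  fromSign-* : ∀ s t → fromSign (s Sign.* t) ≈ fromSign s * fromSign t
  fromSign-* Sign.+ t      = sym (*-identityˡ _)
  fromSign-* Sign.- Sign.+ = sym (*-identityʳ _)
  fromSign-* Sign.- Sign.- = begin
    1#                 ≈⟨ ⁻¹-involutive 1# ⟨
    - - 1#             ≈⟨ -‿cong (*-identityʳ _) ⟨
    - (- 1# * 1#)      ≈⟨ -‿distribʳ-* _ _ ⟩
    - 1# * - 1#        ∎

  fromℤ-◃ : ∀ s n → fromℤ (s ◃ n) ≈ fromSign s * (n · 1#)
  fromℤ-◃ s      zero    = sym (zeroʳ _)
  fromℤ-◃ Sign.+ (suc n) = sym (*-identityˡ _)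
  fromℤ-◃ Sign.- (suc n) = trans (-‿cong (sym (*-identityˡ _))) (-‿distribˡ-* _ _)

  fromℤ-signAbs : ∀ i → fromℤ i ≈ fromSign (sign i) * (∣ i ∣ · 1#)
  fromℤ-signAbs i = ≡.subst (λ j → fromℤ j ≈ fromSign (sign i) * (∣ i ∣ · 1#))
                          (ℤP.◃-inverse i) (fromℤ-◃ (sign i) ∣ i ∣)

  fromℤ-* : ∀ i j → fromℤ (i ℤ.* j) ≈ fromℤ i * fromℤ j
  fromℤ-* i j = begin
    fromℤ (sign i Sign.* sign j ◃ ∣ i ∣ ℕ.* ∣ j ∣)  ≈⟨ fromℤ-◃ (sign i Sign.* sign j) (∣ i ∣ ℕ.* ∣ j ∣) ⟩
    fromSign (sign i Sign.* sign j) * ((∣ i ∣ ℕ.* ∣ j ∣) · 1#)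
      ≈⟨ *-cong (fromSign-* (sign i) (sign j)) (×1-homo-* ∣ i ∣ ∣ j ∣) ⟩
    (σi * σj) * (ni * nj)                            ≈⟨ interchange σi σj ni nj ⟩
    (σi * ni) * (σj * nj)                            ≈⟨ *-cong (fromℤ-signAbs i) (fromℤ-signAbs j) ⟨
    fromℤ i * fromℤ j                                ∎
    where
    σi σj ni nj : Carrier
    σi = fromSign (sign i) ; σj = fromSign (sign j) ; ni = ∣ i ∣ · 1# ; nj = ∣ j ∣ · 1#

  fromℤ-neg : ∀ i → fromℤ (ℤ.- i) ≈ - fromℤ i
  fromℤ-neg (+ zero)  = sym ε⁻¹≈ε
  fromℤ-neg (+ suc n) = refl
  fromℤ-neg -[1+ n ]  = sym (⁻¹-involutive _)

  fromℤ-homomorphism : ℤ.+-*-rawRing -Raw-AlmostCommutative⟶ fromCommutativeRing K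
  fromℤ-homomorphism = record
    { ⟦_⟧ = fromℤ ; +-homo = fromℤ-+ ; *-homo = fromℤ-* ; -‿homo = fromℤ-neg
    ; 0-homo = refl ; 1-homo = refl }

  fromℤ-≟ : ∀ i j → Maybe (fromℤ i ≈ fromℤ j)
  fromℤ-≟ i j with i ℤ.≟ j
  ... | yes ≡.refl = just refl
  ... | no _       = nothing

  open import Algebra.Solver.Ring ℤ.+-*-rawRing (fromCommutativeRing K)
    fromℤ-homomorphism fromℤ-≟ public

module QuadraticAlgebra {c ℓ} (K : CommutativeRing c ℓ) where
  open CommutativeRing K
  open IntegerCoefficients K using (Polynomial; con; _:+_; _:*_; :-_; _:-_; solve; _:=_)
  open import Relation.Binary.Reasoning.Setoid setoid

  ≈L-refl : ∀ {x} → _≈L_ K x x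
  ≈L-refl {_ , _} = refl , refl

  ≈L-sym : ∀ {x y} → _≈L_ K x y → _≈L_ K y x
  ≈L-sym {_ , _} {_ , _} (u≈ , v≈) = sym u≈ , sym v≈

  ≈L-trans : ∀ {x y z} → _≈L_ K x y → _≈L_ K y z → _≈L_ K x z
  ≈L-trans {_ , _} {_ , _} {_ , _} (u≈ , v≈) (u≈′ , v≈′) = trans u≈ u≈′ , trans v≈ v≈′

  mulL-cong : ∀ Δ {x x′ y y′} → _≈L_ K x x′ → _≈L_ K y y′ → _≈L_ K (mulL K Δ x y) (mulL K Δ x′ y′)
  mulL-cong Δ {_ , _} {_ , _} {_ , _} {_ , _} (u≈ , v≈) (u′≈ , v′≈) =
    +-cong (*-cong u≈ u′≈) (-‿cong (*-congˡ (*-cong v≈ v′≈))) ,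
    +-cong (*-cong u≈ v′≈) (*-cong v≈ u′≈)

  normL-cong : ∀ Δ {x y} → _≈L_ K x y → normL K Δ x ≈ normL K Δ y
  normL-cong Δ {_ , _} {_ , _} (u≈ , v≈) = +-cong (*-cong u≈ u≈) (*-congˡ (*-cong v≈ v≈))

  private
    𝟘 𝟙 𝟛 : ∀ {n} → Polynomial n
    𝟘 = con (+ 0)
    𝟙 = con (+ 1)
    𝟛 = 𝟙 :+ 𝟙 :+ 𝟙

  mulL-identityʳ : ∀ Δ x → _≈L_ K (mulL K Δ x (oneL K)) x
  mulL-identityʳ Δ (u , v) =
    solve 3 (λ u v Δ → u :* 𝟙 :- 𝟛 :* Δ :* (v :* 𝟘) := u) refl u v Δ ,
    solve 3 (λ u v Δ → u :* 𝟘 :+ v :* 𝟙 := v) refl u v Δ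

  normL-mulL : ∀ Δ x y → normL K Δ (mulL K Δ x y) ≈ normL K Δ x * normL K Δ y
  normL-mulL Δ (u , v) (u′ , v′) = solve 5 (λ u v u′ v′ Δ →
      (u :* u′ :- 𝟛 :* Δ :* (v :* v′)) :* (u :* u′ :- 𝟛 :* Δ :* (v :* v′))
        :+ 𝟛 :* Δ :* ((u :* v′ :+ v :* u′) :* (u :* v′ :+ v :* u′))
      := (u :* u :+ 𝟛 :* Δ :* (v :* v)) :* (u′ :* u′ :+ 𝟛 :* Δ :* (v′ :* v′)))
    refl u v u′ v′ Δ

  normL-oneL : ∀ Δ → normL K Δ (oneL K) ≈ 1#
  normL-oneL = solve 1 (λ Δ → 𝟙 :* 𝟙 :+ 𝟛 :* Δ :* (𝟘 :* 𝟘) := 𝟙) refl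

  normL-unit : ∀ Δ {w} → IsUnitL K Δ w → Σ[ n ∈ Carrier ] (normL K Δ w * n ≈ 1#)
  normL-unit Δ {w} (w′ , ww′≈1) = normL K Δ w′ , (begin
    normL K Δ w * normL K Δ w′     ≈⟨ normL-mulL Δ w w′ ⟨
    normL K Δ (mulL K Δ w w′)      ≈⟨ normL-cong Δ ww′≈1 ⟩
    normL K Δ (oneL K)             ≈⟨ normL-oneL Δ ⟩
    1#                             ∎)

  isUnitL-resp : ∀ Δ {z w} → _≈L_ K z w → IsUnitL K Δ w → IsUnitL K Δ z
  isUnitL-resp Δ z≈w (w′ , ww′≈1) = w′ , ≈L-trans (mulL-cong Δ z≈w ≈L-refl) ww′≈1

  sameClassL-of-≈L : ∀ Δ {z w} → _≈L_ K z w → SameClassL K Δ z w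
  sameClassL-of-≈L Δ {w = w} z≈w = oneL K , (oneL K , mulL-identityʳ Δ (oneL K)) ,
    ≈L-trans z≈w (≈L-sym (≈L-trans (mulL-cong Δ (≈L-refl {w}) cubeL-oneL) (mulL-identityʳ Δ w)))
    where
    cubeL-oneL : _≈L_ K (cubeL K Δ (oneL K)) (oneL K)
    cubeL-oneL = ≈L-trans (mulL-cong Δ (mulL-identityʳ Δ (oneL K)) ≈L-refl) (mulL-identityʳ Δ (oneL K))

module CardanoPreimage {c ℓ} (K : CommutativeRing c ℓ) where
  open CommutativeRing K
  open IntegerCoefficients K using (Polynomial; con; _:+_; _:*_; :-_; _:-_; _:×_; solve; _:=_)
  open import Relation.Binary.Reasoning.Setoid setoid

  -- k stands for 1/3 and s for 1/(2t).
  cardanoPreimage : (u v Δ s k : Carrier) → BinCubic K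
  cardanoPreimage u v Δ s k =
    form (two K * k * v) (two K * s * u)
         (- (nat K 6 * s * s * Δ * v)) (- (two K * s * s * s * Δ * u))

  private
    𝟘 𝟙 𝟚 𝟛 : ∀ {n} → Polynomial n
    𝟘 = con (+ 0)
    𝟙 = con (+ 1)
    𝟚 = 𝟙 :+ 𝟙
    𝟛 = 𝟙 :+ 𝟙 :+ 𝟙

    cubeP : ∀ {n} → Polynomial n → Polynomial n
    cubeP t = t :* t :* t

    -- Syntactic copies of evalForm, covG (at (1,0)) and disc: their semantics
    -- unfold definitionally to the originals, as ⟦ m :× 𝟙 ⟧ does to nat m.
    module _ {n} (u v Δ s k : Polynomial n) where
      a b c′ d : Polynomial n
      a = 𝟚 :* k :* v
      b = 𝟚 :* s :* u
      c′ = :- (6 :× 𝟙 :* s :* s :* Δ :* v)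
      d = :- (𝟚 :* s :* s :* s :* Δ :* u)

      scaledNormP : Polynomial n
      scaledNormP = cubeP (𝟚 :* s) :* (u :* u :+ 𝟛 :* Δ :* (v :* v))

      evalFormP₁₀ covGP₁₀ discP : Polynomial n
      evalFormP₁₀ = a :* (𝟙 :* 𝟙 :* 𝟙) :+ b :* (𝟙 :* 𝟙 :* 𝟘) :+ c′ :* (𝟙 :* 𝟘 :* 𝟘) :+ d :* (𝟘 :* 𝟘 :* 𝟘)
      covGP₁₀ =
        (2 :× 𝟙 :* (b :* b :* b) :+ 27 :× 𝟙 :* (a :* a) :* d :- 9 :× 𝟙 :* a :* b :* c′) :* (𝟙 :* 𝟙 :* 𝟙)
        :+ 3 :× 𝟙 :* (b :* b :* c′ :+ 9 :× 𝟙 :* a :* b :* d :- 6 :× 𝟙 :* a :* (c′ :* c′)) :* (𝟙 :* 𝟙 :* 𝟘)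
        :- 3 :× 𝟙 :* (b :* (c′ :* c′) :+ 9 :× 𝟙 :* a :* c′ :* d :- 6 :× 𝟙 :* (b :* b) :* d) :* (𝟙 :* 𝟘 :* 𝟘)
        :- (2 :× 𝟙 :* (c′ :* c′ :* c′) :+ 27 :× 𝟙 :* a :* (d :* d) :- 9 :× 𝟙 :* b :* c′ :* d) :* (𝟘 :* 𝟘 :* 𝟘)
      discP =
        b :* b :* (c′ :* c′)
        :- 4 :× 𝟙 :* a :* (c′ :* c′ :* c′)
        :- 4 :× 𝟙 :* (b :* b :* b) :* d
        :- 27 :× 𝟙 :* (a :* a) :* (d :* d)
        :+ 18 :× 𝟙 :* a :* b :* c′ :* d

  cube-cong : ∀ {x y} → x ≈ y → cube K x ≈ cube K y
  cube-cong x≈y = *-cong (*-cong x≈y x≈y) x≈y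

  cube≈0 : ∀ {t} → t ≈ 0# → cube K t ≈ 0#
  cube≈0 {t} t≈0 = trans (cube-cong t≈0) (trans (*-congʳ (zeroˡ 0#)) (zeroˡ 0#))

  private
    ≈-mod : ∀ {x y a b} q → x ≈ y + (a - b) * q → a ≈ b → x ≈ y
    ≈-mod {y = y} {b = b} q x≈ a≈b = begin
      _                 ≈⟨ x≈ ⟩
      y + (_ - b) * q   ≈⟨ +-congˡ (*-congʳ (+-congʳ a≈b)) ⟩
      y + (b - b) * q   ≈⟨ +-congˡ (*-congʳ (-‿inverseʳ b)) ⟩
      y + 0# * q        ≈⟨ +-congˡ (zeroˡ q) ⟩
      y + 0#            ≈⟨ +-identityʳ y ⟩
      y                 ∎

  module _ (u v Δ s k : Carrier) (3k≈1 : three K * k ≈ 1#) where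
    private
      g : BinCubic K
      g = cardanoPreimage u v Δ s k

    cardanoPreimage-evalForm : nat K 3 * evalForm K g 1# 0# ≈ two K * v
    cardanoPreimage-evalForm = ≈-mod (two K * v)
      (solve 5 (λ u v Δ s k → 3 :× 𝟙 :* evalFormP₁₀ u v Δ s k
                  := 𝟚 :* v :+ (𝟛 :* k :- 𝟙) :* (𝟚 :* v)) refl u v Δ s k)
      3k≈1

    cardanoPreimage-covG : covG K g 1# 0# ≈ two K * u * (cube K (two K * s) * normL K Δ (u , v))
    cardanoPreimage-covG = ≈-mod _
      (solve 5 (λ u v Δ s k → covGP₁₀ u v Δ s k
                  := 𝟚 :* u :* scaledNormP u v Δ s k
                     :+ (𝟛 :* k :- 𝟙) :* (:- (24 :× 𝟙 :* cubeP s :* Δ :* u :* (v :* v) :* (𝟛 :* k :- 𝟚))))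
        refl u v Δ s k)
      3k≈1

    cardanoPreimage-disc : disc K g ≈ Δ * (cube K (two K * s) * normL K Δ (u , v)) * (cube K (two K * s) * normL K Δ (u , v))
    cardanoPreimage-disc = ≈-mod _
      (solve 5 (λ u v Δ s k → discP u v Δ s k
                  := Δ :* scaledNormP u v Δ s k :* scaledNormP u v Δ s k
                     :+ (𝟛 :* k :- 𝟙) :* (cubeP s :* cubeP s :* (Δ :* Δ) :* (v :* v)
                          :* (576 :× 𝟙 :* Δ :* (v :* v) :- 48 :× 𝟙 :* (u :* u) :* (𝟛 :* k :- 5 :× 𝟙))))
        refl u v Δ s k)
      3k≈1

  module _ {h : Carrier} (2h≈1 : two K * h ≈ 1#) where
    private
      halve : ∀ x → h * (two K * x) ≈ x
      halve x = begin
        h * (two K * x)   ≈⟨ *-assoc h (two K) x ⟨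
        h * two K * x     ≈⟨ *-congʳ (trans (*-comm h (two K)) 2h≈1) ⟩
        1# * x            ≈⟨ *-identityˡ x ⟩
        x                 ∎

    cardanoPreimage-cardano : ∀ {u v Δ s k} → three K * k ≈ 1#
      → cube K (two K * s) * normL K Δ (u , v) ≈ 1#
      → _≈L_ K (cardano K h (cardanoPreimage u v Δ s k) 1# 0#) (u , v)
    cardanoPreimage-cardano {u} {v} {Δ} {s} {k} 3k≈1 e≈1 =
      trans (*-congˡ (trans (cardanoPreimage-covG u v Δ s k 3k≈1)
                            (trans (*-congˡ e≈1) (*-identityʳ _))))
            (halve u) ,
      trans (*-congˡ (cardanoPreimage-evalForm u v Δ s k 3k≈1)) (halve v)

    scaledNorm≈1 : ∀ {t t⁻¹ n} → t * t⁻¹ ≈ 1# → n ≈ cube K t → cube K (two K * (h * t⁻¹)) * n ≈ 1#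
    scaledNorm≈1 {t} {t⁻¹} {n} tt⁻¹≈1 n≈t³ = begin
      cube K (two K * (h * t⁻¹)) * n        ≈⟨ *-congˡ n≈t³ ⟩
      cube K (two K * (h * t⁻¹)) * cube K t ≈⟨ cube-* (two K) h t t⁻¹ ⟩
      cube K (two K * h * (t * t⁻¹))        ≈⟨ cube-cong (trans (*-cong 2h≈1 tt⁻¹≈1) (*-identityˡ 1#)) ⟩
      cube K 1#                             ≈⟨ cube-1 ⟩
      1#                                    ∎
      where
      cube-* : ∀ a b c d → cube K (a * (b * d)) * cube K c ≈ cube K (a * b * (c * d))
      cube-* = solve 4 (λ a b c d → cubeP (a :* (b :* d)) :* cubeP c := cubeP (a :* b :* (c :* d))) refl
      cube-1 : cube K 1# ≈ 1#
      cube-1 = solve 0 (cubeP 𝟙 := 𝟙) refl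

  cardanoPreimage-disc≈ : ∀ {u v Δ s k} → three K * k ≈ 1#
    → cube K (two K * s) * normL K Δ (u , v) ≈ 1#
    → disc K (cardanoPreimage u v Δ s k) ≈ Δ
  cardanoPreimage-disc≈ {u} {v} {Δ} {s} {k} 3k≈1 e≈1 = begin
    disc K (cardanoPreimage u v Δ s k)  ≈⟨ cardanoPreimage-disc u v Δ s k 3k≈1 ⟩
    Δ * _ * _                           ≈⟨ *-cong (*-congˡ e≈1) e≈1 ⟩
    Δ * 1# * 1#                         ≈⟨ *-identityʳ _ ⟩
    Δ * 1#                              ≈⟨ *-identityʳ Δ ⟩
    Δ                                   ∎

module _ {c ℓ} {K : CommutativeRing c ℓ} (F : IsField K) where
  open CommutativeRing K

  invertible⇒≉0 : ∀ {x y} → x * y ≈ 1# → ¬ (x ≈ 0#)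
  invertible⇒≉0 {x} {y} xy≈1 x≈0 = IsField.one≉zero F
    (trans (sym xy≈1) (trans (*-congʳ x≈0) (zeroˡ y)))

proposition4p4 : ∀ {c ℓ : Level} (K : CommutativeRing c ℓ)
    → (F : IsField K)
    → (char≠2 : ¬ (CommutativeRing._≈_ K (two K) (CommutativeRing.0# K)))
    → (char≠3 : ¬ (CommutativeRing._≈_ K (three K) (CommutativeRing.0# K)))
    → (Δ : CommutativeRing.Carrier K)
    → ¬ (CommutativeRing._≈_ K Δ (CommutativeRing.0# K))
    → (w : L K)
    → IsUnitL K Δ w
    → NormIsCube K Δ w
    → Σ[ g ∈ BinCubic K ]
        (CommutativeRing._≈_ K (disc K g) Δ × CardanoInvIs K (half K F char≠2) Δ g w)
proposition4p4 K F char≠2 char≠3 Δ _ (u , v) w-unit (t , Nw≈t³) =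
  cardanoPreimage u v Δ s k , cardanoPreimage-disc≈ 3k≈1 e≈1 ,
  1# , 0# , isUnitL-resp Δ C≈w w-unit , sameClassL-of-≈L Δ C≈w
  where
  open CommutativeRing K
  open QuadraticAlgebra K
  open CardanoPreimage K

  h k : Carrier
  h = half K F char≠2
  k = proj₁ (IsField.inverse F (three K) char≠3)

  2h≈1 : two K * h ≈ 1#
  2h≈1 = proj₂ (IsField.inverse F (two K) char≠2)

  3k≈1 : three K * k ≈ 1#
  3k≈1 = proj₂ (IsField.inverse F (three K) char≠3)

  t≉0 : ¬ (t ≈ 0#)
  t≉0 t≈0 = invertible⇒≉0 F (proj₂ (normL-unit Δ w-unit)) (trans Nw≈t³ (cube≈0 t≈0))

  s : Carrier
  s = h * proj₁ (IsField.inverse F t t≉0)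

  e≈1 : cube K (two K * s) * normL K Δ (u , v) ≈ 1#
  e≈1 = scaledNorm≈1 2h≈1 (proj₂ (IsField.inverse F t t≉0)) Nw≈t³

  C≈w : _≈L_ K (cardano K h (cardanoPreimage u v Δ s k) 1# 0#) (u , v)
  C≈w = cardanoPreimage-cardano 2h≈1 3k≈1 e≈1
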